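{- Let $\Delta$ be a strongly shellable simplicial complex of positive dimension. Then $\overline{\operatorname{pure}_1}(\Delta)$ is also strongly shellable.
   Context: A simplicial complex is a finite family of subsets of a vertex set closed under taking subsets; $\mathcal{F}(\Delta)$ is its set of facets, $\dim(A)=|A|-1$. A linear order $F_1,\dots,F_t$ of $\mathcal{F}(\Delta)$ is a strong shelling order if for every $1\le i<j\le t$ there exists $k$ with $1\le k<j$ such that $|F_j\setminus F_k|=1$, $F_j\setminus F_k\subseteq F_j\setminus F_i$, and $F_k\setminus F_j\subseteq F_i$; $\Delta$ is strongly shellable if such an order exists. For $k\ge 0$, $\overline{\operatorname{pure}_k}(\Delta)$ denotes the pure complex generated by the $k$-dimensional facets of $\Delta$. -}

module Defs where

open import Data.Nat using (ℕ; _<_; _≥_)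
open import Data.Fin using (Fin; toℕ)
open import Data.Fin.Subset using (Subset; _⊆_; _─_; ∣_∣)
open import Data.List using (List; length; lookup)
open import Data.List.Relation.Unary.Unique.Propositional using (Unique)
import Data.List.Membership.Propositional as LM
open import Data.Product using (Σ; ∃; ∃-syntax; _×_)
open import Function.Bundles using (_⇔_)
open import Relation.Binary.PropositionalEquality using (_≡_)

record SimplicialComplex (n : ℕ) : Set₁ where
  field
    face     : Subset n → Set
    downward : ∀ {A B} → A ⊆ B → face B → face A
open SimplicialComplex public

IsFacet : ∀ {n} → SimplicialComplex n → Subset n → Set
IsFacet Δ F = face Δ F × (∀ G → face Δ G → F ⊆ G → G ≡ F)

-- Δ has positive dimension: some face has dimension ≥ 1, i.e. |A| ≥ 2
-- (dim A = |A| - 1; dim Δ is the maximum dimension of a face).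
PositiveDim : ∀ {n} → SimplicialComplex n → Set
PositiveDim Δ = ∃[ A ] (face Δ A × ∣ A ∣ ≥ 2)

FacetList : ∀ {n} → SimplicialComplex n → List (Subset n) → Set
FacetList Δ L = Unique L × (∀ F → (F LM.∈ L) ⇔ IsFacet Δ F)

StrongShellingCondition : ∀ {n} → List (Subset n) → Set
StrongShellingCondition L =
  ∀ (i j : Fin (length L)) → toℕ i < toℕ j →
    ∃[ k ] (toℕ k < toℕ j
           × ∣ lookup L j ─ lookup L k ∣ ≡ 1
           × (lookup L j ─ lookup L k) ⊆ (lookup L j ─ lookup L i)
           × (lookup L k ─ lookup L j) ⊆ lookup L i)

IsStrongShellingOrder : ∀ {n} → SimplicialComplex n → List (Subset n) → Set
IsStrongShellingOrder Δ L = FacetList Δ L × StrongShellingCondition L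

StronglyShellable : ∀ {n} → SimplicialComplex n → Set
StronglyShellable Δ = ∃[ L ] IsStrongShellingOrder Δ L

-- \overline{pure_k}(Δ): the complex generated by the k-dimensional facets
-- of Δ (those with |F| = k + 1).
pureClosure : ∀ {n} → ℕ → SimplicialComplex n → SimplicialComplex n
pureClosure {n} k Δ = record
  { face     = λ A → ∃[ F ] (IsFacet Δ F × ∣ F ∣ ≡ Data.Nat.suc k × A ⊆ F)
  ; downward = λ { A⊆B (F , fF , cF , B⊆F) → F , fF , cF , λ x → B⊆F (A⊆B x) }
  }
  where open import Data.Product using (_,_)
        import Data.Nat

-- In a strong shelling order consider two 1-dimensional facets F_i, F_j (i < j) and
-- a witness F_k. Since |F_j ∖ F_k| = 1, F_k meets F_j in one vertex, and F_k ∖ F_j ⊆ F_i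
-- has at most two vertices. No vertex would force F_k ⊆ F_j and two would force
-- F_i ⊆ F_k; both are impossible between distinct facets. So F_k is again an edge
-- (a 2-element facet), and the subsequence of edges of the order is a strong shelling of pure_1(Δ).
module Submission where

open import Data.Nat using (ℕ)
open import Defs

open import Data.Nat using (suc; _≤_; _<_; _+_; z≤n; s≤s; _≟_)
open import Data.Nat.Properties using (+-suc; suc-injective; ≤-pred; n≮0; <-irrefl; ≤-<-trans)
open import Data.Bool using (true; false)
open import Data.Vec using ([]; _∷_)
open import Data.Fin using (Fin; toℕ; zero; suc)
open import Data.Fin.Subset using (Subset; _⊆_; _─_; _∩_; _-_; ∣_∣)
open import Data.Fin.Subset.Properties
  using (_∈?_; ⊆-antisym; ∩-comm; p⊆q⇒∣p∣≤∣q∣; p─q⊆p; x∈p∧x∉q⇒x∈p─q;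
         x∈p∧x≢y⇒x∈p-y; x∈p⇒∣p-x∣<∣p∣)
open import Data.List using (List; []; _∷_; length; lookup; filter)
import Data.List.Membership.Propositional as List
open import Data.List.Membership.Propositional.Properties using (∈-filter⁺; ∈-filter⁻; ∈-lookup)
open import Data.List.Relation.Unary.Unique.Propositional.Properties using (filter⁺)
open import Data.Product using (∃-syntax; _×_; _,_)
open import Function.Bundles using (mk⇔; Equivalence)
open import Relation.Binary.PropositionalEquality using (_≡_; refl; sym; trans; cong; cong₂; subst; module ≡-Reasoning)
open import Relation.Nullary using (yes; no; contradiction)
open import Relation.Unary using (Pred; Decidable)

∣p∣≡∣p─q∣+∣p∩q∣ : ∀ {n} (p q : Subset n) → ∣ p ∣ ≡ ∣ p ─ q ∣ + ∣ p ∩ q ∣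
∣p∣≡∣p─q∣+∣p∩q∣ []          []          = refl
∣p∣≡∣p─q∣+∣p∩q∣ (true ∷ p)  (true ∷ q)  = trans (cong suc (∣p∣≡∣p─q∣+∣p∩q∣ p q)) (sym (+-suc _ _))
∣p∣≡∣p─q∣+∣p∩q∣ (true ∷ p)  (false ∷ q) = cong suc (∣p∣≡∣p─q∣+∣p∩q∣ p q)
∣p∣≡∣p─q∣+∣p∩q∣ (false ∷ p) (true ∷ q)  = ∣p∣≡∣p─q∣+∣p∩q∣ p q
∣p∣≡∣p─q∣+∣p∩q∣ (false ∷ p) (false ∷ q) = ∣p∣≡∣p─q∣+∣p∩q∣ p q

∣p─q∣≡0⇒p⊆q : ∀ {n} (p q : Subset n) → ∣ p ─ q ∣ ≡ 0 → p ⊆ q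
∣p─q∣≡0⇒p⊆q p q ∣p─q∣≡0 {x} x∈p with x ∈? q
... | yes x∈q = x∈q
... | no  x∉q = contradiction
  (subst (∣ p ─ q - x ∣ <_) ∣p─q∣≡0 (x∈p⇒∣p-x∣<∣p∣ (x∈p∧x∉q⇒x∈p─q x∈p x∉q))) n≮0

p⊆q∧∣p∣≡∣q∣⇒p≡q : ∀ {n} {p q : Subset n} → p ⊆ q → ∣ p ∣ ≡ ∣ q ∣ → p ≡ q
p⊆q∧∣p∣≡∣q∣⇒p≡q {p = p} {q} p⊆q ∣p∣≡∣q∣ = ⊆-antisym p⊆q q⊆p
  where
  q⊆p : q ⊆ p
  q⊆p {x} x∈q with x ∈? p
  ... | yes x∈p = x∈p
  ... | no  x∉p = contradiction ∣p∣≡∣q∣ λ eq →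
        <-irrefl eq (≤-<-trans (p⊆q⇒∣p∣≤∣q∣ p⊆q-x) (x∈p⇒∣p-x∣<∣p∣ x∈q))
    where
    p⊆q-x : p ⊆ q - x
    p⊆q-x y∈p = x∈p∧x≢y⇒x∈p-y (p⊆q y∈p) λ { refl → x∉p y∈p }

ShellingStep : ∀ {n} → Subset n → Subset n → Subset n → Set
ShellingStep Fi Fj Fk = ∣ Fj ─ Fk ∣ ≡ 1 × (Fj ─ Fk) ⊆ (Fj ─ Fi) × (Fk ─ Fj) ⊆ Fi

shellingStep-edge : ∀ {n} {Fi Fj Fk : Subset n} → ∣ Fi ∣ ≡ 2 → ∣ Fj ∣ ≡ 2 →
                    ShellingStep Fi Fj Fk → (Fk ⊆ Fj → Fk ≡ Fj) → (Fi ⊆ Fk → Fi ≡ Fk) →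
                    ∣ Fk ∣ ≡ 2
shellingStep-edge {Fi = Fi} {Fj} {Fk} ∣Fi∣≡2 ∣Fj∣≡2 (∣Fj─Fk∣≡1 , _ , Fk─Fj⊆Fi) Fk⊆Fj⇒≡ Fi⊆Fk⇒≡ =
  from-∣Fk─Fj∣ (subst (∣ Fk ─ Fj ∣ ≤_) ∣Fi∣≡2 (p⊆q⇒∣p∣≤∣q∣ Fk─Fj⊆Fi)) refl
  where
  ∣Fk∩Fj∣≡1 : ∣ Fk ∩ Fj ∣ ≡ 1
  ∣Fk∩Fj∣≡1 = trans (cong ∣_∣ (∩-comm Fk Fj)) (suc-injective (begin
    suc ∣ Fj ∩ Fk ∣            ≡⟨ cong (_+ ∣ Fj ∩ Fk ∣) (sym ∣Fj─Fk∣≡1) ⟩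
    ∣ Fj ─ Fk ∣ + ∣ Fj ∩ Fk ∣  ≡⟨ sym (∣p∣≡∣p─q∣+∣p∩q∣ Fj Fk) ⟩
    ∣ Fj ∣                     ≡⟨ ∣Fj∣≡2 ⟩
    2                          ∎))
    where open ≡-Reasoning

  from-∣Fk─Fj∣ : ∀ {m} → m ≤ 2 → ∣ Fk ─ Fj ∣ ≡ m → ∣ Fk ∣ ≡ 2
  from-∣Fk─Fj∣ {0} _ e = trans (cong ∣_∣ (Fk⊆Fj⇒≡ (∣p─q∣≡0⇒p⊆q Fk Fj e))) ∣Fj∣≡2
  from-∣Fk─Fj∣ {1} _ e = trans (∣p∣≡∣p─q∣+∣p∩q∣ Fk Fj) (cong₂ _+_ e ∣Fk∩Fj∣≡1)
  from-∣Fk─Fj∣ {2} _ e = trans (cong ∣_∣ (sym (Fi⊆Fk⇒≡ Fi⊆Fk))) ∣Fi∣≡2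
    where
    Fi⊆Fk : Fi ⊆ Fk
    Fi⊆Fk = subst (_⊆ Fk) (p⊆q∧∣p∣≡∣q∣⇒p≡q Fk─Fj⊆Fi (trans e (sym ∣Fi∣≡2))) (p─q⊆p Fk Fj)
  from-∣Fk─Fj∣ {suc (suc (suc _))} (s≤s (s≤s ())) _

module _ {a p} {A : Set a} {P : Pred A p} (P? : Decidable P) where

  filterIndex : ∀ xs → Fin (length (filter P? xs)) → Fin (length xs)
  filterIndex (x ∷ xs) with P? x
  ... | yes _ = λ { zero → zero ; (suc i) → suc (filterIndex xs i) }
  ... | no  _ = λ i → suc (filterIndex xs i)

  lookup-filterIndex : ∀ xs i → lookup xs (filterIndex xs i) ≡ lookup (filter P? xs) i
  lookup-filterIndex (x ∷ xs) with P? x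
  ... | yes _ = λ { zero → refl ; (suc i) → lookup-filterIndex xs i }
  ... | no  _ = lookup-filterIndex xs

  P-lookup-filterIndex : ∀ xs i → P (lookup xs (filterIndex xs i))
  P-lookup-filterIndex (x ∷ xs) with P? x
  ... | yes px = λ { zero → px ; (suc i) → P-lookup-filterIndex xs i }
  ... | no  _  = P-lookup-filterIndex xs

  filterIndex-mono-< : ∀ xs i j → toℕ i < toℕ j → toℕ (filterIndex xs i) < toℕ (filterIndex xs j)
  filterIndex-mono-< (x ∷ xs) with P? x
  ... | yes _ = λ { zero (suc j) _ → s≤s z≤n
                  ; (suc i) (suc j) (s≤s i<j) → s≤s (filterIndex-mono-< xs i j i<j) }
  ... | no  _ = λ i j i<j → s≤s (filterIndex-mono-< xs i j i<j)

  filterIndex-cancel-< : ∀ xs i j → toℕ (filterIndex xs i) < toℕ (filterIndex xs j) → toℕ i < toℕ j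
  filterIndex-cancel-< (x ∷ xs) with P? x
  ... | yes _ = λ { zero (suc j) _ → s≤s z≤n
                  ; (suc i) (suc j) (s≤s i<j) → s≤s (filterIndex-cancel-< xs i j i<j) }
  ... | no  _ = λ i j i<j → filterIndex-cancel-< xs i j (≤-pred i<j)

  filterIndex-surjective : ∀ xs k → P (lookup xs k) → ∃[ k′ ] filterIndex xs k′ ≡ k
  filterIndex-surjective (x ∷ xs) with P? x
  ... | yes _ = λ { zero _ → zero , refl
                  ; (suc k) pk → let k′ , eq = filterIndex-surjective xs k pk in suc k′ , cong suc eq }
  ... | no ¬px = λ { zero px → contradiction px ¬px
                   ; (suc k) pk → let k′ , eq = filterIndex-surjective xs k pk in k′ , cong suc eq }

filter-strongShelling : ∀ {n p} {P : Pred (Subset n) p} (P? : Decidable P) {L : List (Subset n)} →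
  (∀ {Fi Fj Fk} → Fi List.∈ L → Fj List.∈ L → Fk List.∈ L →
     P Fi → P Fj → ShellingStep Fi Fj Fk → P Fk) →
  StrongShellingCondition L → StrongShellingCondition (filter P? L)
filter-strongShelling P? {L} inherits shelling i j i<j
  with k , k<j , step ← shelling (filterIndex P? L i) (filterIndex P? L j) (filterIndex-mono-< P? L i j i<j)
  with k′ , refl ← filterIndex-surjective P? L k
         (inherits (∈-lookup _) (∈-lookup _) (∈-lookup k)
            (P-lookup-filterIndex P? L i) (P-lookup-filterIndex P? L j) step)
  rewrite lookup-filterIndex P? L i | lookup-filterIndex P? L j | lookup-filterIndex P? L k′
  = k′ , filterIndex-cancel-< P? L k′ j k<j , step

module _ {n} (Δ : SimplicialComplex n) where

  isFacet-⊆⇒≡ : ∀ {F G} → IsFacet Δ F → IsFacet Δ G → F ⊆ G → F ≡ G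
  isFacet-⊆⇒≡ (_ , F-maximal) (G-face , _) F⊆G = sym (F-maximal _ G-face F⊆G)

  isFacet-pureClosure⁺ : ∀ {k F} → IsFacet Δ F → ∣ F ∣ ≡ suc k → IsFacet (pureClosure k Δ) F
  isFacet-pureClosure⁺ {F = F} F-facet ∣F∣≡1+k = (F , F-facet , ∣F∣≡1+k , λ x∈F → x∈F) , F-maximal
    where
    F-maximal : ∀ G → face (pureClosure _ Δ) G → F ⊆ G → G ≡ F
    F-maximal G (H , H-facet , _ , G⊆H) F⊆G =
      ⊆-antisym (subst (G ⊆_) (sym (isFacet-⊆⇒≡ F-facet H-facet (λ x∈F → G⊆H (F⊆G x∈F)))) G⊆H) F⊆G

  isFacet-pureClosure⁻ : ∀ {k F} → IsFacet (pureClosure k Δ) F → IsFacet Δ F × ∣ F ∣ ≡ suc k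
  isFacet-pureClosure⁻ {F = F} ((H , H-facet , ∣H∣≡1+k , F⊆H) , F-maximal)
    with refl ← F-maximal H (H , H-facet , ∣H∣≡1+k , λ x∈H → x∈H) F⊆H
    = H-facet , ∣H∣≡1+k

  facetList-pureClosure : ∀ {k L} → FacetList Δ L →
                          FacetList (pureClosure k Δ) (filter (λ F → ∣ F ∣ ≟ suc k) L)
  facetList-pureClosure {k} {L} (unique , ∈⇔facet) = filter⁺ size? unique , λ F → mk⇔
    (λ F∈L′ → let F∈L , ∣F∣≡1+k = ∈-filter⁻ size? F∈L′ in
                isFacet-pureClosure⁺ (Equivalence.to (∈⇔facet F) F∈L) ∣F∣≡1+k)
    (λ F-facet′ → let F-facet , ∣F∣≡1+k = isFacet-pureClosure⁻ F-facet′ in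
                ∈-filter⁺ size? (Equivalence.from (∈⇔facet F) F-facet) ∣F∣≡1+k)
    where
    size? : Decidable (λ (F : Subset n) → ∣ F ∣ ≡ suc k)
    size? F = ∣ F ∣ ≟ suc k

proposition2p12 : ∀ {n : ℕ} (Δ : SimplicialComplex n) →
    PositiveDim Δ → StronglyShellable Δ → StronglyShellable (pureClosure 1 Δ)
proposition2p12 Δ _ (L , facets@(_ , ∈⇔facet) , shelling) =
  filter (λ F → ∣ F ∣ ≟ 2) L ,
  facetList-pureClosure Δ facets ,
  filter-strongShelling (λ F → ∣ F ∣ ≟ 2) witness-isEdge shelling
  where
  isFacet : ∀ {F} → F List.∈ L → IsFacet Δ F
  isFacet {F} = Equivalence.to (∈⇔facet F)

  witness-isEdge : ∀ {Fi Fj Fk} → Fi List.∈ L → Fj List.∈ L → Fk List.∈ L →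
                ∣ Fi ∣ ≡ 2 → ∣ Fj ∣ ≡ 2 → ShellingStep Fi Fj Fk → ∣ Fk ∣ ≡ 2
  witness-isEdge Fi∈L Fj∈L Fk∈L ∣Fi∣≡2 ∣Fj∣≡2 step = shellingStep-edge ∣Fi∣≡2 ∣Fj∣≡2 step
    (isFacet-⊆⇒≡ Δ (isFacet Fk∈L) (isFacet Fj∈L)) (isFacet-⊆⇒≡ Δ (isFacet Fi∈L) (isFacet Fk∈L))
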